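{- Let $L$ be a finite nonempty set of integers. The map $\psi$ is a bijection between plane alternative trees with a black root (respectively, a white root) labeled by $L$ and permutations with support $L$ whose last letter is $\max(L)$ (respectively, $\min(L)$).
   Context: A vertex of a labeled rooted tree is minimal (maximal) if its label is smaller (larger) than the labels of all its descendants. A plane alternative tree is a rooted plane tree with pairwise distinct integer labels and black/white vertices such that: - every white vertex is minimal, and its children are black with labels decreasing from left to right; - every black vertex is maximal, and its children are white with labels increasing from left to right. A permutation here is a finite word over the integers with no repeated letter; its support is the set of its letters. For a plane alternative tree $T$, $\psi(T)$ is defined recursively: - if $T$ is a single vertex labeled $m$, then $\psi(T)=m$; - otherwise, if the root is labeled $m$ and $T_1,\dots,T_k$ are its subtrees from left to right, then $\psi(T)=\psi(T_1)\psi(T_2)\cdots\psi(T_k)\,m$ (concatenation, i.e. the postorder traversal). -}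

module Defs where

open import Data.Integer using (ℤ; _<_; _≤_)
open import Data.List using (List; []; _∷_; _++_; [_])
open import Data.List.Relation.Unary.All using (All)
open import Data.List.Relation.Unary.Unique.Propositional using (Unique)
open import Data.List.Relation.Unary.Linked using (Linked)
open import Data.List.Membership.Propositional using (_∈_)
open import Data.Product using (Σ; _×_; ∃)
open import Function.Bundles using (_⇔_)
open import Relation.Binary.PropositionalEquality using (_≡_)

data Tree : Set where
  node : ℤ → List Tree → Tree

root : Tree → ℤ
root (node m _) = m

mutual
  labels : Tree → List ℤ
  labels (node m ts) = m ∷ labelsF ts

  labelsF : List Tree → List ℤ
  labelsF [] = []
  labelsF (t ∷ ts) = labels t ++ labelsF ts

mutual
  ψ : Tree → List ℤ
  ψ (node m ts) = ψF ts ++ [ m ]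

  ψF : List Tree → List ℤ
  ψF [] = []
  ψF (t ∷ ts) = ψ t ++ ψF ts

data Colour : Set where
  black white : Colour

-- Alt c T : T is an alternative tree (without the global distinctness
-- condition) whose root has colour c; colours of the other vertices are
-- determined (they alternate).
mutual
  data Alt : Colour → Tree → Set where
    alt-white : ∀ {m ts} → AltF black ts → All (m <_) (labelsF ts) →
                Linked (λ s t → root t < root s) ts → Alt white (node m ts)
    alt-black : ∀ {m ts} → AltF white ts → All (_< m) (labelsF ts) →
                Linked (λ s t → root s < root t) ts → Alt black (node m ts)

  data AltF : Colour → List Tree → Set where
    []  : ∀ {c} → AltF c []
    _∷_ : ∀ {c t ts} → Alt c t → AltF c ts → AltF c (t ∷ ts)

SameSet : List ℤ → List ℤ → Set
SameSet xs ys = ∀ x → (x ∈ xs) ⇔ (x ∈ ys)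

PlaneAltTree : Colour → List ℤ → Tree → Set
PlaneAltTree c L T = Alt c T × Unique (labels T) × SameSet (labels T) L

IsMax IsMin : ℤ → List ℤ → Set
IsMax m L = m ∈ L × All (_≤ m) L
IsMin m L = m ∈ L × All (m ≤_) L

Extreme : Colour → ℤ → List ℤ → Set
Extreme black = IsMax
Extreme white = IsMin

PermEnding : Colour → List ℤ → List ℤ → Set
PermEnding c L w = Unique w × SameSet w L ×
                   Σ ℤ (λ m → Extreme c m L × Σ (List ℤ) (λ u → w ≡ u ++ [ m ]))

module Submission where

-- Both colours are handled at once through the order  x <[ c ] y,  which is
-- x < y for c = white and y < x for c = black: a vertex of colour c is
-- <[ c ]-least in its subtree, and its children form an (opp c)-forest, i.e.
-- a list of alternative trees of colour opp c whose roots increase in the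
-- <[ opp c ]-order.  The first root x of a d-forest is therefore the
-- <[ d ]-least label of the forest, and the postorder word of the forest
-- splits as  a ++ x ∷ b,  a being the word of the children of x and b the
-- word of the remaining trees.  Conversely every word without repeated
-- letters splits in exactly one such way, at its <[ d ]-least letter.
-- Recursing on this splitting shows that ψF is a bijection from d-forests
-- onto repetition-free words (injectivity, then existence by recursion on
-- the length).  The theorem follows by appending the root, which is the
-- last letter of ψ T; the labels of a tree are a permutation of ψ T, which
-- transports distinctness and the support between trees and words.

open import Defs
open import Data.Integer using (ℤ)
open import Data.List using (List; [])
open import Data.List.Relation.Unary.Unique.Propositional using (Unique)
open import Data.Product using (Σ; _×_)
open import Relation.Binary.PropositionalEquality using (_≡_; _≢_)

open import Data.Integer using (_<_; _≤_)
import Data.Integer.Properties as ℤ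
open import Data.Nat as Nat using (suc; s≤s)
import Data.Nat.Properties as NatP
open import Data.List using (_∷_; _++_; [_]; length)
open import Data.List.Properties using (++-assoc; ++-conicalʳ; ∷-injective; ∷ʳ-injective)
open import Data.List.Relation.Unary.All as All using (All; []; _∷_)
import Data.List.Relation.Unary.All.Properties as AllP
open import Data.List.Relation.Unary.AllPairs using ([]; _∷_)
open import Data.List.Relation.Unary.Linked as Linked using (Linked; []; [-]; _∷_)
open import Data.List.Relation.Unary.Linked.Properties using (Linked⇒All)
open import Data.List.Relation.Unary.Any using (here; there)
open import Data.List.Membership.Propositional using (_∈_)
open import Data.List.Membership.Propositional.Properties using (∈-∃++; ∈-++⁺ˡ; ∈-++⁺ʳ)
open import Data.List.Relation.Binary.Permutation.Propositional using (_↭_; prep; trans; ↭-sym; ↭⇒↭ₛ)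
open import Data.List.Relation.Binary.Permutation.Propositional.Properties
  using (All-resp-↭; ∈-resp-↭; ∷↭∷ʳ; ++⁺)
open import Relation.Binary.PropositionalEquality as Eq using (refl; sym; subst; subst₂; ≢-sym; setoid)
open import Data.List.Relation.Binary.Permutation.Setoid.Properties (setoid ℤ)
  using (Unique-resp-↭)
open import Data.Product using (_,_; proj₁; proj₂; Σ-syntax)
open import Data.Sum using (_⊎_; inj₁; inj₂)
open import Data.Empty using (⊥; ⊥-elim)
open import Function.Base using (_∘_)
open import Function.Bundles using (mk⇔; Equivalence)
open import Relation.Binary.Definitions using (tri<; tri≈; tri>)

opp : Colour → Colour
opp white = black
opp black = white

-- x <[ c ] y: y lies strictly beyond x in the direction in which the
-- labels of a subtree with root colour c move away from its root.
_<[_]_ : ℤ → Colour → ℤ → Set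
x <[ white ] y = x < y
x <[ black ] y = y < x

_≤[_]_ : ℤ → Colour → ℤ → Set
x ≤[ c ] y = x ≡ y ⊎ x <[ c ] y

<[]-trans : ∀ c {x y z} → x <[ c ] y → y <[ c ] z → x <[ c ] z
<[]-trans white p q = ℤ.<-trans p q
<[]-trans black p q = ℤ.<-trans q p

<[]-asym : ∀ c {x y} → x <[ c ] y → y <[ c ] x → ⊥
<[]-asym white p q = ℤ.<-asym p q
<[]-asym black p q = ℤ.<-asym p q

<[]-irrefl : ∀ c {x y} → x <[ c ] y → x ≢ y
<[]-irrefl white p = ℤ.<⇒≢ p
<[]-irrefl black p = ≢-sym (ℤ.<⇒≢ p)

<[]-cmp : ∀ c x y → x ≡ y ⊎ x <[ c ] y ⊎ y <[ c ] x
<[]-cmp c x y with ℤ.<-cmp x y | c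
... | tri≈ _ x≡y _ | _     = inj₁ x≡y
... | tri< x<y _ _ | white = inj₂ (inj₁ x<y)
... | tri< x<y _ _ | black = inj₂ (inj₂ x<y)
... | tri> _ _ y<x | white = inj₂ (inj₂ y<x)
... | tri> _ _ y<x | black = inj₂ (inj₁ y<x)

<[]-≤[]-trans : ∀ c {x y z} → x <[ c ] y → y ≤[ c ] z → x <[ c ] z
<[]-≤[]-trans c p (inj₁ refl) = p
<[]-≤[]-trans c p (inj₂ q)    = <[]-trans c p q

≤[]-antisym : ∀ c {x y} → x ≤[ c ] y → y ≤[ c ] x → x ≡ y
≤[]-antisym c (inj₁ x≡y) _          = x≡y
≤[]-antisym c (inj₂ _)   (inj₁ y≡x) = sym y≡x
≤[]-antisym c (inj₂ p)   (inj₂ q)   = ⊥-elim (<[]-asym c p q)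

strictly : ∀ c {x} {a : List ℤ} → All (x ≤[ c ]_) a → All (x ≢_) a → All (x <[ c ]_) a
strictly c ≤a ≢a = All.zipWith strict (≤a , ≢a)
  where
  strict : ∀ {x y} → x ≤[ c ] y × x ≢ y → x <[ c ] y
  strict (inj₁ x≡y , x≢y) = ⊥-elim (x≢y x≡y)
  strict (inj₂ x<y , _)   = x<y

unique-split : ∀ a {x : ℤ} {b} → Unique (a ++ x ∷ b) →
               Unique a × Unique b × All (x ≢_) a × All (x ≢_) b
unique-split []      (x∉b ∷ ub) = [] , ub , [] , x∉b
unique-split (y ∷ a) (y∉ ∷ u) with unique-split a u | AllP.++⁻ a y∉
... | ua , ub , x∉a , x∉b | y∉a , (y≢x ∷ _) = (y∉a ∷ ua) , ub , (≢-sym y≢x ∷ x∉a) , x∉b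

split-least : ∀ c {x : ℤ} {a b y} → All (x <[ c ]_) a → All (x <[ c ]_) b →
              y ∈ a ++ x ∷ b → x ≤[ c ] y
split-least c {x} x<a x<b =
  All.lookup {P = x ≤[ c ]_} (AllP.++⁺ (All.map inj₂ x<a) (inj₁ refl ∷ All.map inj₂ x<b))

split-cancel : ∀ c {x : ℤ} a a′ {b b′} → All (x <[ c ]_) a → All (x <[ c ]_) a′ →
               a ++ x ∷ b ≡ a′ ++ x ∷ b′ → a ≡ a′ × b ≡ b′
split-cancel c []      []       _          _            e = refl , proj₂ (∷-injective e)
split-cancel c []      (_ ∷ _)  _          (x<y ∷ _)    e =
  ⊥-elim (<[]-irrefl c x<y (proj₁ (∷-injective e)))
split-cancel c (_ ∷ _) []       (x<y ∷ _)  _            e =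
  ⊥-elim (<[]-irrefl c x<y (sym (proj₁ (∷-injective e))))
split-cancel c (y ∷ a) (_ ∷ a′) (_ ∷ x<a)  (_ ∷ x<a′)   e with ∷-injective e
... | refl , e′ with split-cancel c a a′ x<a x<a′ e′
... | refl , b≡b′ = refl , b≡b′

-- A word has at most one splitting  a ++ x ∷ b  with a and b strictly
-- beyond x: x is the least letter of the word, and then a, b are determined.
split-unique : ∀ c {x x′ : ℤ} a a′ {b b′} →
               All (x <[ c ]_) a → All (x <[ c ]_) b →
               All (x′ <[ c ]_) a′ → All (x′ <[ c ]_) b′ →
               a ++ x ∷ b ≡ a′ ++ x′ ∷ b′ → a ≡ a′ × x ≡ x′ × b ≡ b′
split-unique c {x} {x′} a a′ x<a x<b x′<a′ x′<b′ e
  with ≤[]-antisym c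
         (split-least c x<a x<b (subst (x′ ∈_) (sym e) (∈-++⁺ʳ a′ (here refl))))
         (split-least c x′<a′ x′<b′ (subst (x ∈_) e (∈-++⁺ʳ a (here refl))))
... | refl with split-cancel c a a′ x<a x′<a′ e
... | a≡a′ , b≡b′ = a≡a′ , refl , b≡b′

least : ∀ c (y : ℤ) u → Σ[ x ∈ ℤ ] (x ∈ y ∷ u × All (x ≤[ c ]_) (y ∷ u))
least c y []      = y , here refl , inj₁ refl ∷ []
least c y (z ∷ u) with least c z u
... | x , x∈ , x≤ with <[]-cmp c y x
... | inj₁ refl        = x , there x∈ , inj₁ refl ∷ x≤
... | inj₂ (inj₂ x<y)  = x , there x∈ , inj₂ x<y ∷ x≤
... | inj₂ (inj₁ y<x)  = y , here refl , inj₁ refl ∷ All.map (inj₂ ∘ <[]-≤[]-trans c y<x) x≤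

SplitAt : Colour → ℤ → List ℤ → Set
SplitAt c x w = Σ[ a ∈ List ℤ ] Σ[ b ∈ List ℤ ]
  (w ≡ a ++ x ∷ b × Unique a × Unique b × All (x <[ c ]_) a × All (x <[ c ]_) b)

split-at-least : ∀ c {x w} → x ∈ w → Unique w → All (x ≤[ c ]_) w → SplitAt c x w
split-at-least c x∈ uw x≤ with ∈-∃++ x∈
... | a , b , refl with unique-split a uw | AllP.++⁻ a x≤
... | ua , ub , x∉a , x∉b | x≤a , _ ∷ x≤b =
  a , b , refl , ua , ub , strictly c x≤a x∉a , strictly c x≤b x∉b

empty-or-split : ∀ c (w : List ℤ) → Unique w → w ≡ [] ⊎ Σ[ x ∈ ℤ ] SplitAt c x w
empty-or-split c []      _  = inj₁ refl
empty-or-split c (y ∷ u) uw with least c y u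
... | x , x∈ , x≤ = inj₂ (x , split-at-least c x∈ uw x≤)

shorter-left : ∀ (a : List ℤ) x b → length a Nat.< length (a ++ x ∷ b)
shorter-left []      x b = s≤s Nat.z≤n
shorter-left (_ ∷ a) x b = s≤s (shorter-left a x b)

shorter-right : ∀ (a : List ℤ) x b → length b Nat.< length (a ++ x ∷ b)
shorter-right []      x b = NatP.≤-refl
shorter-right (_ ∷ a) x b = NatP.m≤n⇒m≤1+n (shorter-right a x b)

mutual
  labels↭ψ : ∀ t → labels t ↭ ψ t
  labels↭ψ (node m ts) = trans (prep m (labelsF↭ψF ts)) (∷↭∷ʳ m (ψF ts))

  labelsF↭ψF : ∀ ts → labelsF ts ↭ ψF ts
  labelsF↭ψF []       = _↭_.refl
  labelsF↭ψF (t ∷ ts) = ++⁺ (labels↭ψ t) (labelsF↭ψF ts)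

SameSet-resp-↭ : ∀ {xs ys L : List ℤ} → xs ↭ ys → SameSet xs L → SameSet ys L
SameSet-resp-↭ p same x = mk⇔ (λ x∈ys → Equivalence.to (same x) (∈-resp-↭ (↭-sym p) x∈ys))
                              (λ x∈L → ∈-resp-↭ p (Equivalence.from (same x) x∈L))

All-resp-SameSet : ∀ {P : ℤ → Set} {xs ys} → SameSet xs ys → All P xs → All P ys
All-resp-SameSet same Pxs = All.tabulate λ y∈ys → All.lookup Pxs (Equivalence.from (same _) y∈ys)

-- A c-forest: alternative trees of root colour c with roots increasing in
-- the c-order; the children of a vertex of colour opp c form such a forest.
RootsIncreasing : Colour → List Tree → Set
RootsIncreasing c = Linked (λ s t → root s <[ c ] root t)

Forest : Colour → List Tree → Set
Forest c ts = AltF c ts × RootsIncreasing c ts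

Alt-node⁺ : ∀ c {m ts} → Forest (opp c) ts → All (m <[ c ]_) (ψF ts) → Alt c (node m ts)
Alt-node⁺ white {ts = ts} (alt , inc) m<ts =
  alt-white alt (All-resp-↭ (↭-sym (labelsF↭ψF ts)) m<ts) inc
Alt-node⁺ black {ts = ts} (alt , inc) m<ts =
  alt-black alt (All-resp-↭ (↭-sym (labelsF↭ψF ts)) m<ts) inc

Alt-node⁻ : ∀ {c m ts} → Alt c (node m ts) → Forest (opp c) ts × All (m <[ c ]_) (ψF ts)
Alt-node⁻ (alt-white {ts = ts} alt m<ts inc) = (alt , inc) , All-resp-↭ (labelsF↭ψF ts) m<ts
Alt-node⁻ (alt-black {ts = ts} alt m<ts inc) = (alt , inc) , All-resp-↭ (labelsF↭ψF ts) m<ts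

ψF-∷ : ∀ x as ts → ψF (node x as ∷ ts) ≡ ψF as ++ x ∷ ψF ts
ψF-∷ x as ts = ++-assoc (ψF as) [ x ] (ψF ts)

-- The word of a nonempty forest ends with a root, so it is nonempty.
ψF-nonempty : ∀ x as ts → ψF (node x as ∷ ts) ≢ []
ψF-nonempty x as ts e with () ← ++-conicalʳ (ψF as) _ (Eq.trans (sym (ψF-∷ x as ts)) e)

beyond-roots : ∀ {c x ts} → AltF c ts → All (λ t → x <[ c ] root t) ts → All (x <[ c ]_) (ψF ts)
beyond-roots []                          []            = []
beyond-roots {c} (_∷_ {t = node y bs} alt alts) (x<y ∷ x<ts) =
  AllP.++⁺ (AllP.++⁺ (All.map (<[]-trans c x<y) (proj₂ (Alt-node⁻ alt))) (x<y ∷ []))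
           (beyond-roots alts x<ts)

-- The first root of a forest is its least label: a forest splits as its
-- first root, the forest of that root's children, and the remaining forest.
Forest-∷⁻ : ∀ {c x as ts} → Forest c (node x as ∷ ts) →
            Forest (opp c) as × Forest c ts × All (x <[ c ]_) (ψF as) × All (x <[ c ]_) (ψF ts)
Forest-∷⁻ {c} (alt ∷ alts , inc) =
  proj₁ (Alt-node⁻ alt) , (alts , Linked.tail inc) , proj₂ (Alt-node⁻ alt) ,
  beyond-roots alts (roots-beyond-first inc)
  where
  roots-beyond-first : ∀ {t ts} → RootsIncreasing c (t ∷ ts) → All (λ s → root t <[ c ] root s) ts
  roots-beyond-first     [-]          = []
  roots-beyond-first {t} (t<s ∷ inc′) = Linked⇒All (<[]-trans c) {v = t} t<s inc′

Forest-∷⁺ : ∀ {c x as ts} → Forest (opp c) as → Forest c ts →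
            All (x <[ c ]_) (ψF as) → All (x <[ c ]_) (ψF ts) → Forest c (node x as ∷ ts)
Forest-∷⁺ {c} {x} {as} {ts} fas (alts , inc) x<as x<ts =
  (Alt-node⁺ c fas x<as ∷ alts) , link ts inc x<ts
  where
  -- the root of the first tree is the last letter of that tree's word
  link : ∀ ts → RootsIncreasing c ts → All (x <[ c ]_) (ψF ts) → RootsIncreasing c (node x as ∷ ts)
  link []                 _   _    = [-]
  link (node y bs ∷ ts′)  inc x<ts rewrite ψF-∷ y bs ts′ = All.head (AllP.++⁻ʳ (ψF bs) x<ts) ∷ inc

-- A forest is determined by its postorder word: both words split at their
-- least letter, which is the first root, and the parts are compared recursively.
ψF-injective : ∀ {c} ts ts′ → Forest c ts → Forest c ts′ → ψF ts ≡ ψF ts′ → ts ≡ ts′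
ψF-injective [] [] _ _ _ = refl
ψF-injective [] (node x as ∷ ts) _ _ e = ⊥-elim (ψF-nonempty x as ts (sym e))
ψF-injective (node x as ∷ ts) [] _ _ e = ⊥-elim (ψF-nonempty x as ts e)
ψF-injective {c} (node x as ∷ ts) (node x′ as′ ∷ ts′) f f′ e
  with Forest-∷⁻ f | Forest-∷⁻ f′
... | fas , fts , x<as , x<ts | fas′ , fts′ , x′<as′ , x′<ts′
  with split-unique c (ψF as) (ψF as′) x<as x<ts x′<as′ x′<ts′
         (subst₂ _≡_ (ψF-∷ x as ts) (ψF-∷ x′ as′ ts′) e)
... | as≡ , refl , ts≡
  with ψF-injective as as′ fas fas′ as≡ | ψF-injective ts ts′ fts fts′ ts≡
... | refl | refl = refl

-- Every repetition-free word is the postorder word of a c-forest: split it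
-- at its least letter x, which becomes the first root.  The fuel n bounds
-- the length of the word.
forest-of : ∀ n c (w : List ℤ) → length w Nat.< n → Unique w →
            Σ[ ts ∈ List Tree ] (Forest c ts × ψF ts ≡ w)
forest-of (suc n) c w (s≤s |w|≤n) uw with empty-or-split c w uw
... | inj₁ refl = [] , ([] , []) , refl
... | inj₂ (x , a , b , refl , ua , ub , x<a , x<b)
  with forest-of n (opp c) a (NatP.<-≤-trans (shorter-left a x b) |w|≤n) ua
     | forest-of n c b (NatP.<-≤-trans (shorter-right a x b) |w|≤n) ub
... | as , fas , refl | ts , fts , refl =
  node x as ∷ ts , Forest-∷⁺ fas fts x<a x<b , ψF-∷ x as ts

extreme-intro : ∀ c {m L} → m ∈ L → All (m ≤[ c ]_) L → Extreme c m L
extreme-intro white m∈L m≤L = m∈L , All.map weak m≤L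
  where weak : ∀ {m y} → m ≤[ white ] y → m ≤ y
        weak (inj₁ refl) = ℤ.≤-refl
        weak (inj₂ m<y)  = ℤ.<⇒≤ m<y
extreme-intro black m∈L m≤L = m∈L , All.map weak m≤L
  where weak : ∀ {m y} → m ≤[ black ] y → y ≤ m
        weak (inj₁ refl) = ℤ.≤-refl
        weak (inj₂ y<m)  = ℤ.<⇒≤ y<m

extreme-elim : ∀ c {m L y} → Extreme c m L → y ∈ L → m ≢ y → m <[ c ] y
extreme-elim white (_ , m≤L) y∈L m≢y = ℤ.≤∧≢⇒< (All.lookup m≤L y∈L) m≢y
extreme-elim black (_ , L≤m) y∈L m≢y = ℤ.≤∧≢⇒< (All.lookup L≤m y∈L) (≢-sym m≢y)

-- ψ maps plane alternative trees to permutations ending with the extreme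
-- label: its letters are the labels, and the root, which is c-least, comes last.
ψ-perm : ∀ c L T → PlaneAltTree c L T → PermEnding c L (ψ T)
ψ-perm c L T@(node m ts) (alt , distinct , support) =
  Unique-resp-↭ (↭⇒↭ₛ (labels↭ψ T)) distinct , ψ-support ,
  m , extreme-intro c (Equivalence.to (support m) (here refl)) (All-resp-SameSet ψ-support m≤ψ) ,
  ψF ts , refl
  where
  ψ-support : SameSet (ψ T) L
  ψ-support = SameSet-resp-↭ (labels↭ψ T) support
  m≤ψ : All (m ≤[ c ]_) (ψ T)
  m≤ψ = AllP.++⁺ (All.map inj₂ (proj₂ (Alt-node⁻ alt))) (inj₁ refl ∷ [])

-- ψ is injective: remove the common last letter and compare the forests.
ψ-injective : ∀ {c} T T′ → Alt c T → Alt c T′ → ψ T ≡ ψ T′ → T ≡ T′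
ψ-injective (node m ts) (node m′ ts′) alt alt′ e with ∷ʳ-injective (ψF ts) (ψF ts′) e
... | ts≡ , refl with ψF-injective ts ts′ (proj₁ (Alt-node⁻ alt)) (proj₁ (Alt-node⁻ alt′)) ts≡
... | refl = refl

-- ψ is surjective: a permutation u ++ [ m ] with m extreme is ψ of the
-- tree whose root m carries the forest of u.
ψ-surjective : ∀ c L w → PermEnding c L w → Σ Tree (λ T → PlaneAltTree c L T × ψ T ≡ w)
ψ-surjective c L _ (distinct , support , m , extreme , u , refl) with unique-split u distinct
... | u-distinct , _ , m∉u , _ with forest-of (suc (length u)) (opp c) u NatP.≤-refl u-distinct
... | ts , fts , refl =
  node m ts ,
  (Alt-node⁺ c fts m<u ,
   Unique-resp-↭ (↭⇒↭ₛ (↭-sym (labels↭ψ (node m ts)))) distinct ,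
   SameSet-resp-↭ (↭-sym (labels↭ψ (node m ts))) support) ,
  refl
  where
  m<u : All (m <[ c ]_) (ψF ts)
  m<u = All.tabulate λ y∈u →
    extreme-elim c extreme (Equivalence.to (support _) (∈-++⁺ˡ y∈u)) (All.lookup m∉u y∈u)

-- Lemma 5.2.
lemma5p2 : (L : List ℤ) → Unique L → L ≢ [] → (c : Colour) →
    ((T : Tree) → PlaneAltTree c L T → PermEnding c L (ψ T))
    × ((T T′ : Tree) → PlaneAltTree c L T → PlaneAltTree c L T′ → ψ T ≡ ψ T′ → T ≡ T′)
    × ((w : List ℤ) → PermEnding c L w → Σ Tree (λ T → PlaneAltTree c L T × ψ T ≡ w))
lemma5p2 L _ _ c =
  ψ-perm c L ,
  (λ T T′ (alt , _) (alt′ , _) → ψ-injective T T′ alt alt′) ,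
  ψ-surjective c L
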